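{- Every subcubic caterpillar is a pivot-minor of a path.
   Context: A tree is subcubic if it has at least two vertices and every vertex of degree other than $1$ has degree $3$. A caterpillar is a tree containing a path $P$ such that every vertex of the tree is at distance at most $1$ from some vertex of $P$. Local complementation at $v$ in $G=(V,E)$ gives $G*v=(V,E\,\Delta\,\{xy:xv,yv\in E,x\ne y\})$; pivoting an edge $uv$ gives $G\wedge uv=G*u*v*u$; a pivot-minor of $G$ is a graph obtained from $G$ by a sequence of vertex deletions and pivotings of edges. -}

module Defs where

open import Data.Nat using (ℕ; zero; suc; _+_; _≤_)
open import Data.Fin using (Fin; toℕ; punchIn; _≟_)
open import Data.Bool using (Bool; true; false; not; _∧_; _∨_; _xor_; if_then_else_)
open import Relation.Nullary using (¬_)
open import Data.List using (List; []; _∷_; _++_; length; map; allFin)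
open import Data.Nat.ListAction using (sum)
open import Data.List.Relation.Unary.Unique.Propositional using (Unique)
open import Data.List.Relation.Unary.Any using (Any)
open import Data.Product using (Σ; ∃; _×_; _,_)
open import Data.Sum using (_⊎_)
open import Relation.Nullary.Decidable using (⌊_⌋)
open import Relation.Binary.PropositionalEquality using (_≡_)
open import Function.Bundles using (_⤖_; Bijection)
import Data.Nat as ℕ

Graph : ℕ → Set
Graph n = Fin n → Fin n → Bool

record IsSimple {n : ℕ} (G : Graph n) : Set where
  field
    symmetric   : ∀ x y → G x y ≡ G y x
    irreflexive : ∀ x → G x x ≡ false

deg : ∀ {n} → Graph n → Fin n → ℕ
deg {n} G v = sum (map (λ x → if G v x then 1 else 0) (allFin n))

data IsWalk {n : ℕ} (G : Graph n) : List (Fin n) → Set where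
  nil  : IsWalk G []
  one  : ∀ x → IsWalk G (x ∷ [])
  cons : ∀ {x y vs} → G x y ≡ true → IsWalk G (y ∷ vs) → IsWalk G (x ∷ y ∷ vs)

data Walk {n : ℕ} (G : Graph n) : Fin n → Fin n → Set where
  here : ∀ {x} → Walk G x x
  step : ∀ {x z y} → G x z ≡ true → Walk G z y → Walk G x y

Connected : ∀ {n} → Graph n → Set
Connected G = ∀ x y → Walk G x y

HasCycle : ∀ {n} → Graph n → Set
HasCycle {n} G = Σ (Fin n) λ x → Σ (List (Fin n)) λ ws →
  (2 ≤ length ws) × Unique (x ∷ ws) × IsWalk G (x ∷ ws ++ x ∷ [])

record IsTree {n : ℕ} (G : Graph n) : Set where
  field
    simple    : IsSimple G
    connected : Connected G
    acyclic   : ¬ HasCycle G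

record IsSubcubicTree {n : ℕ} (G : Graph n) : Set where
  field
    tree     : IsTree G
    twoVerts : 2 ≤ n
    degrees  : ∀ v → deg G v ≡ 1 ⊎ deg G v ≡ 3

IsPathIn : ∀ {n} → Graph n → List (Fin n) → Set
IsPathIn G P = (1 ≤ length P) × Unique P × IsWalk G P

record IsCaterpillar {n : ℕ} (G : Graph n) : Set where
  field
    tree  : IsTree G
    spine : List (Fin n)
    spinePath : IsPathIn G spine
    dominated : ∀ x → Any (λ p → x ≡ p ⊎ G x p ≡ true) spine

localComp : ∀ {n} → Graph n → Fin n → Graph n
localComp G v x y = G x y xor (not ⌊ x ≟ y ⌋ ∧ G x v ∧ G y v)

pivot : ∀ {n} → Graph n → Fin n → Fin n → Graph n
pivot G u v = localComp (localComp (localComp G u) v) u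

delete : ∀ {n} → Graph (suc n) → Fin (suc n) → Graph n
delete G i x y = G (punchIn i x) (punchIn i y)

_≅_ : ∀ {m n} → Graph m → Graph n → Set
_≅_ {m} {n} H G = Σ (Fin m ⤖ Fin n) λ f →
  ∀ x y → H x y ≡ G (Bijection.to f x) (Bijection.to f y)

data _≤pm_ : ∀ {m n} → Graph m → Graph n → Set where
  iso : ∀ {m n} {H : Graph m} {G : Graph n} → H ≅ G → H ≤pm G
  piv : ∀ {m n} {H : Graph m} {G : Graph n} (u v : Fin n) →
        G u v ≡ true → H ≤pm pivot G u v → H ≤pm G
  del : ∀ {m n} {H : Graph m} {G : Graph (suc n)} (i : Fin (suc n)) →
        H ≤pm delete G i → H ≤pm G

pathGraph : (n : ℕ) → Graph n
pathGraph n x y = ⌊ suc (toℕ x) ℕ.≟ toℕ y ⌋ ∨ ⌊ suc (toℕ y) ℕ.≟ toℕ x ⌋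

-- We first choose a dominating spine
-- p 0, …, p s whose two ends are leaves (prepending a leaf at either end if
-- needed).  In a subcubic tree every inner spine vertex then has exactly one
-- pendant leaf, and every vertex is a spine vertex or such a leaf.  Now take
-- the path 0 – 1 – … – 3s and pivot, for j = 0, …, s-1 in turn, the edge
-- (3j+1, 3j+2): pivoting the middle edge of the induced path
-- 3j – 3j+1 – 3j+2 – 3j+3 joins 3j to 3j+3 and leaves 3j+1 hanging from 3j+3,
-- and later pivots never touch these vertices again.  Hence the sites 3i
-- (for p i) and 3j+1 (for the leaf of p (j+1)) induce a copy of G; deleting
-- the other vertices and undoing the pivots shows G is a pivot-minor of the path.
module Submission where

open import Defs
open import Data.Nat as ℕ using (ℕ; zero; suc; pred; _+_; _*_; _∸_; _≤_; _<_; z≤n; s≤s; _≤?_)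
open import Data.Nat.Properties
  using (≤-refl; ≤-reflexive; ≤-trans; ≤-<-trans; ≤-pred; <⇒≤pred; ≤-antisym; ≤-total; <⇒≤; <⇒≢; <-irrefl;
         <-cmp; ≮⇒≥; n≤1+n; m≤m+n; m≤n+m; m≤n⇒m<n∨m≡n; m≤n⇒∃[o]m+o≡n; m≢1+n+m; suc-injective;
         +-suc; +-identityʳ; *-monoˡ-≤; *-cancelʳ-≡; m∸n≤m; n∸n≡0; ∸-cancelˡ-≡; +-∸-assoc; m∸[m∸n]≡n;
         m+[n∸m]≡n)
open import Data.Nat.DivMod using (_mod_; m<n⇒m%n≡m)
open import Data.Nat.ListAction using (sum)
open import Data.Fin as F using (Fin; toℕ; punchOut)
open import Data.Fin.Properties
  using (toℕ-injective; toℕ-fromℕ<; toℕ<n; punchIn-punchOut; punchOut-injective; any?; all?)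
open import Data.Bool using (Bool; true; false; not; _∧_; _∨_; _xor_; if_then_else_)
open import Data.Bool.Properties
  using (∧-zeroʳ; ∧-comm; ∨-comm; xor-identityʳ; xor-comm; ¬-not) renaming (_≟_ to _≟ᵇ_)
open import Data.List using (List; []; _∷_; _++_; length; map; filter; allFin)
open import Data.List.Properties using (filter-notAll; ++-assoc; length-++)
open import Data.List.Membership.Propositional using (_∈_)
open import Data.List.Membership.Propositional.Properties using (∈-filter⁺; ∈-filter⁻; ∈-allFin)
open import Data.List.Relation.Unary.Any as Any using (Any; here; there)
open import Data.List.Relation.Unary.All as All using (All; []; _∷_)
open import Data.List.Relation.Unary.AllPairs using ([]; _∷_)
open import Data.List.Relation.Unary.Unique.Propositional using (Unique)
import Data.List.Relation.Unary.Unique.Propositional.Properties as Unique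
open import Data.Product using (∃; _×_; _,_; proj₁; proj₂)
open import Data.Sum using (_⊎_; inj₁; inj₂)
open import Data.Empty using (⊥; ⊥-elim)
open import Function using (_∘_)
open import Function.Bundles using (mk⤖)
open import Function.Definitions using (Injective; Surjective)
open import Relation.Nullary using (¬_; Dec; yes; no; ¬?; contradiction; _×-dec_)
open import Relation.Nullary.Decidable using (⌊_⌋; isYes≗does; dec-true; dec-false)
open import Relation.Binary using (tri<; tri≈; tri>)
open import Relation.Binary.Definitions using (DecidableEquality)
open import Relation.Binary.PropositionalEquality

⌊⌋-true : ∀ {P : Set} (d : Dec P) → P → ⌊ d ⌋ ≡ true
⌊⌋-true d p = trans (isYes≗does d) (dec-true d p)

⌊⌋-false : ∀ {P : Set} (d : Dec P) → ¬ P → ⌊ d ⌋ ≡ false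
⌊⌋-false d ¬p = trans (isYes≗does d) (dec-false d ¬p)

-- Local complementation and pivoting for Boolean adjacency functions on any
-- vertex type with decidable equality; on Fin n these are exactly the
-- operations 'localComp' and 'pivot' of Defs.
module LocalComplementation {A : Set} (_≟_ : DecidableEquality A) where

  lc : (A → A → Bool) → A → A → A → Bool
  lc G w x y = G x y xor (not ⌊ x ≟ y ⌋ ∧ G x w ∧ G y w)

  pivotAt : (A → A → Bool) → A → A → A → A → Bool
  pivotAt G u v = lc (lc (lc G u) v) u

  record Simple (G : A → A → Bool) : Set where
    field
      symmetric : ∀ x y → G x y ≡ G y x
      loopless  : ∀ x → G x x ≡ false

  module _ (G : A → A → Bool) {w x y : A} where

    private
      δ : Bool
      δ = not ⌊ x ≟ y ⌋

    lc-nonadjˡ : G x w ≡ false → lc G w x y ≡ G x y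
    lc-nonadjˡ x≁w = begin
      G x y xor (δ ∧ G x w ∧ G y w) ≡⟨ cong (λ b → G x y xor (δ ∧ b ∧ G y w)) x≁w ⟩
      G x y xor (δ ∧ false)         ≡⟨ cong (G x y xor_) (∧-zeroʳ δ) ⟩
      G x y xor false               ≡⟨ xor-identityʳ _ ⟩
      G x y                         ∎
      where open ≡-Reasoning

    lc-nonadjʳ : G y w ≡ false → lc G w x y ≡ G x y
    lc-nonadjʳ y≁w = begin
      G x y xor (δ ∧ G x w ∧ G y w) ≡⟨ cong (λ b → G x y xor (δ ∧ G x w ∧ b)) y≁w ⟩
      G x y xor (δ ∧ G x w ∧ false) ≡⟨ cong (λ b → G x y xor (δ ∧ b)) (∧-zeroʳ (G x w)) ⟩
      G x y xor (δ ∧ false)         ≡⟨ cong (G x y xor_) (∧-zeroʳ δ) ⟩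
      G x y xor false               ≡⟨ xor-identityʳ _ ⟩
      G x y                         ∎
      where open ≡-Reasoning

    lc-common : G x w ≡ true → G y w ≡ true → x ≢ y → lc G w x y ≡ not (G x y)
    lc-common x∼w y∼w x≢y = begin
      G x y xor (δ ∧ G x w ∧ G y w) ≡⟨ cong₂ (λ d b → G x y xor (not d ∧ b)) (⌊⌋-false (x ≟ y) x≢y)
                                                                            (cong₂ _∧_ x∼w y∼w) ⟩
      G x y xor true                ≡⟨ xor-comm (G x y) true ⟩
      not (G x y)                   ∎
      where open ≡-Reasoning

  lc-diag : ∀ G w x → lc G w x x ≡ G x x
  lc-diag G w x rewrite ⌊⌋-true (x ≟ x) refl = xor-identityʳ (G x x)

  ≟-sym : ∀ x y → ⌊ x ≟ y ⌋ ≡ ⌊ y ≟ x ⌋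
  ≟-sym x y with x ≟ y | y ≟ x
  ... | yes _   | yes _   = refl
  ... | no _    | no _    = refl
  ... | yes x≡y | no y≢x  = contradiction (sym x≡y) y≢x
  ... | no x≢y  | yes y≡x = contradiction (sym y≡x) x≢y

  lc-simple : ∀ {G} w → Simple G → Simple (lc G w)
  lc-simple {G} w S = record { symmetric = sym′ ; loopless = λ x → trans (lc-diag G w x) (loopless x) }
    where
      open Simple S
      sym′ : ∀ x y → lc G w x y ≡ lc G w y x
      sym′ x y rewrite symmetric x y | ≟-sym x y | ∧-comm (G x w) (G y w) = refl

  pivot-simple : ∀ {G} u v → Simple G → Simple (pivotAt G u v)
  pivot-simple u v S = lc-simple u (lc-simple v (lc-simple u S))

  pivot-farˡ : ∀ G {u v x y} → G x u ≡ false → G x v ≡ false → pivotAt G u v x y ≡ G x y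
  pivot-farˡ G {u} {v} {x} {y} x≁u x≁v =
    trans (lc-nonadjˡ L₂ x≁u₂) (trans (lc-nonadjˡ L₁ x≁v₁) (lc-nonadjˡ G x≁u))
    where
      L₁ = lc G u
      L₂ = lc L₁ v
      x≁v₁ : L₁ x v ≡ false
      x≁v₁ = trans (lc-nonadjˡ G x≁u) x≁v
      x≁u₂ : L₂ x u ≡ false
      x≁u₂ = trans (lc-nonadjˡ L₁ x≁v₁) (trans (lc-nonadjˡ G x≁u) x≁u)

  pivot-farʳ : ∀ G {u v x y} → Simple G → G y u ≡ false → G y v ≡ false → pivotAt G u v x y ≡ G x y
  pivot-farʳ G {u} {v} {x} {y} S y≁u y≁v =
    trans (Simple.symmetric (pivot-simple u v S) x y)
          (trans (pivot-farˡ G y≁u y≁v) (Simple.symmetric S y x))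

  record InducedP4 (G : A → A → Bool) (a u v b : A) : Set where
    field
      a∼u : G a u ≡ true
      u∼v : G u v ≡ true
      v∼b : G v b ≡ true
      a≁v : G a v ≡ false
      u≁b : G u b ≡ false
      a≁b : G a b ≡ false
      a≢v : a ≢ v
      a≢b : a ≢ b
      u≢b : u ≢ b

  pivot-P4 : ∀ {G a u v b} → Simple G → InducedP4 G a u v b →
    (pivotAt G u v a b ≡ true) × (pivotAt G u v u b ≡ true) × (pivotAt G u v a u ≡ false)
  pivot-P4 {G} {a} {u} {v} {b} S P =
    trans (lc-nonadjˡ L₂ a≁u₂) a∼b₂ ,
    trans (lc-nonadjˡ L₂ u≁u₂) u∼b₂ ,
    trans (lc-nonadjˡ L₂ a≁u₂) a≁u₂
    where
      open Simple S
      open InducedP4 P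
      L₁ = lc G u
      L₂ = lc L₁ v
      v∼u : G v u ≡ true
      v∼u = trans (symmetric v u) u∼v
      b≁u : G b u ≡ false
      b≁u = trans (symmetric b u) u≁b
      a≢u : a ≢ u
      a≢u refl = contradiction (trans (sym a∼u) (loopless a)) (λ ())
      -- complementing at u joins a to v and leaves the other relevant pairs alone
      a∼v₁ : L₁ a v ≡ true
      a∼v₁ = trans (lc-common G a∼u v∼u a≢v) (cong not a≁v)
      a∼u₁ : L₁ a u ≡ true
      a∼u₁ = trans (lc-nonadjʳ G (loopless u)) a∼u
      u∼v₁ : L₁ u v ≡ true
      u∼v₁ = trans (lc-nonadjˡ G (loopless u)) u∼v
      b∼v₁ : L₁ b v ≡ true
      b∼v₁ = trans (lc-nonadjˡ G b≁u) (trans (symmetric b v) v∼b)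
      a≁b₁ : L₁ a b ≡ false
      a≁b₁ = trans (lc-nonadjʳ G b≁u) a≁b
      u≁b₁ : L₁ u b ≡ false
      u≁b₁ = trans (lc-nonadjˡ G (loopless u)) u≁b
      -- complementing at v toggles the three pairs among its neighbours a, u, b
      a≁u₂ : L₂ a u ≡ false
      a≁u₂ = trans (lc-common L₁ a∼v₁ u∼v₁ a≢u) (cong not a∼u₁)
      a∼b₂ : L₂ a b ≡ true
      a∼b₂ = trans (lc-common L₁ a∼v₁ b∼v₁ a≢b) (cong not a≁b₁)
      u∼b₂ : L₂ u b ≡ true
      u∼b₂ = trans (lc-common L₁ u∼v₁ b∼v₁ u≢b) (cong not u≁b₁)
      u≁u₂ : L₂ u u ≡ false
      u≁u₂ = trans (lc-diag L₁ v u) (trans (lc-diag G u u) (loopless u))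

open LocalComplementation ℕ._≟_

-- The one-way infinite path on ℕ; 'pathGraph n' is its restriction to Fin n.
pathℕ : ℕ → ℕ → Bool
pathℕ X Y = ⌊ suc X ℕ.≟ Y ⌋ ∨ ⌊ suc Y ℕ.≟ X ⌋

data Gap : ℕ → ℕ → Set where
  same   : ∀ {i} → Gap i i
  next   : ∀ {i} → Gap i (suc i)
  prev   : ∀ {i} → Gap (suc i) i
  apart< : ∀ {i j} → 2 + i ≤ j → Gap i j
  apart> : ∀ {i j} → 2 + j ≤ i → Gap i j

gap : ∀ i j → Gap i j
gap zero          zero          = same
gap zero          (suc zero)    = next
gap zero          (suc (suc j)) = apart< (s≤s (s≤s z≤n))
gap (suc zero)    zero          = prev
gap (suc (suc i)) zero          = apart> (s≤s (s≤s z≤n))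
gap (suc i)       (suc j)       with gap i j
... | same       = same
... | next       = next
... | prev       = prev
... | apart< i≪j = apart< (s≤s i≪j)
... | apart> j≪i = apart> (s≤s j≪i)

pathℕ-simple : Simple pathℕ
pathℕ-simple = record
  { symmetric = λ X Y → ∨-comm ⌊ suc X ℕ.≟ Y ⌋ ⌊ suc Y ℕ.≟ X ⌋
  ; loopless  = λ X → cong₂ _∨_ (⌊⌋-false (suc X ℕ.≟ X) (m≢1+n+m X {0} ∘ sym))
                                 (⌊⌋-false (suc X ℕ.≟ X) (m≢1+n+m X {0} ∘ sym))
  }

pathℕ-next : ∀ X → pathℕ X (suc X) ≡ true
pathℕ-next X = cong (_∨ ⌊ suc (suc X) ℕ.≟ X ⌋) (⌊⌋-true (suc X ℕ.≟ suc X) refl)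

pathℕ-apart< : ∀ X Y → 2 + X ≤ Y → pathℕ X Y ≡ false
pathℕ-apart< X Y X≪Y = cong₂ _∨_ (⌊⌋-false (suc X ℕ.≟ Y) (<⇒≢ X≪Y))
                                     (⌊⌋-false (suc Y ℕ.≟ X) (<⇒≢ X<1+Y ∘ sym))
  where
    X<1+Y : X < suc Y
    X<1+Y = s≤s (≤-trans (m≤n+m X 2) X≪Y)

pathℕ-apart> : ∀ X Y → 2 + Y ≤ X → pathℕ X Y ≡ false
pathℕ-apart> X Y Y≪X = trans (Simple.symmetric pathℕ-simple X Y) (pathℕ-apart< Y X Y≪X)

-- The path on ℕ after pivoting, in order, the edges (1 + i * 3, 2 + i * 3)
-- for i < j.  The i-th pivot acts on the induced P4 on i*3, …, 3 + i*3.
chain : ℕ → ℕ → ℕ → Bool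
chain zero    = pathℕ
chain (suc j) = pivotAt (chain j) (1 + j * 3) (2 + j * 3)

chain-simple : ∀ j → Simple (chain j)
chain-simple zero    = pathℕ-simple
chain-simple (suc j) = pivot-simple _ _ (chain-simple j)

chain-sym : ∀ j X Y → chain j X Y ≡ chain j Y X
chain-sym j = Simple.symmetric (chain-simple j)

chain-untouched : ∀ j X Y → 1 + j * 3 ≤ X → chain j X Y ≡ pathℕ X Y
chain-untouched zero    _ _ _ = refl
chain-untouched (suc j) X Y 4+3j≤X =
  trans (pivot-farˡ (chain j) X≁u X≁v) (chain-untouched j X Y 1+3j≤X)
  where
    1+3j≤X : 1 + j * 3 ≤ X
    1+3j≤X = ≤-trans (m≤n+m _ 3) 4+3j≤X
    X≁u : chain j X (1 + j * 3) ≡ false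
    X≁u = trans (chain-untouched j X _ 1+3j≤X) (pathℕ-apart> X _ (≤-trans (n≤1+n _) 4+3j≤X))
    X≁v : chain j X (2 + j * 3) ≡ false
    X≁v = trans (chain-untouched j X _ 1+3j≤X) (pathℕ-apart> X _ 4+3j≤X)

chain-untouchedʳ : ∀ j X Y → 1 + j * 3 ≤ Y → chain j X Y ≡ pathℕ X Y
chain-untouchedʳ j X Y h =
  trans (chain-sym j X Y) (trans (chain-untouched j Y X h) (Simple.symmetric pathℕ-simple Y X))

chain-frozen : ∀ i X Y → X < i * 3 → chain (suc i) X Y ≡ chain i X Y
chain-frozen i X Y X<3i = pivot-farˡ (chain i) X≁u X≁v
  where
    X≁u : chain i X (1 + i * 3) ≡ false
    X≁u = trans (chain-untouchedʳ i X _ ≤-refl) (pathℕ-apart< X _ (s≤s X<3i))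
    X≁v : chain i X (2 + i * 3) ≡ false
    X≁v = trans (chain-untouchedʳ i X _ (n≤1+n _)) (pathℕ-apart< X _ (≤-trans (s≤s X<3i) (n≤1+n _)))

chain-stable : ∀ {i j} X Y → X < i * 3 → i ≤ j → chain j X Y ≡ chain i X Y
chain-stable {i} {j} X Y X<3i i≤j with m≤n⇒m<n∨m≡n i≤j
... | inj₂ refl = refl
chain-stable {i} {suc j} X Y X<3i _ | inj₁ (s≤s i≤j) =
  trans (chain-frozen j X Y (≤-trans X<3i (*-monoˡ-≤ 3 i≤j))) (chain-stable X Y X<3i i≤j)

chain-P4 : ∀ j → InducedP4 (chain j) (j * 3) (1 + j * 3) (2 + j * 3) (3 + j * 3)
chain-P4 j = record
  { a∼u = trans (chain-untouchedʳ j a u ≤-refl) (pathℕ-next a)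
  ; u∼v = trans (chain-untouched j u v ≤-refl) (pathℕ-next u)
  ; v∼b = trans (chain-untouched j v b (n≤1+n _)) (pathℕ-next v)
  ; a≁v = trans (chain-untouchedʳ j a v (n≤1+n _)) (pathℕ-apart< a v ≤-refl)
  ; u≁b = trans (chain-untouched j u b ≤-refl) (pathℕ-apart< u b ≤-refl)
  ; a≁b = trans (chain-untouchedʳ j a b (≤-trans (n≤1+n _) (n≤1+n _))) (pathℕ-apart< a b (n≤1+n _))
  ; a≢v = m≢1+n+m (j * 3) {1}
  ; a≢b = m≢1+n+m (j * 3) {2}
  ; u≢b = m≢1+n+m (1 + j * 3) {1}
  }
  where
    a = j * 3
    u = 1 + j * 3
    v = 2 + j * 3
    b = 3 + j * 3

module _ {s j : ℕ} (j<s : j < s) where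

  private
    keep : ∀ X Y → X < 3 + j * 3 → chain s X Y ≡ chain (suc j) X Y
    keep X Y X<3+3j = chain-stable X Y X<3+3j j<s

    P4 = pivot-P4 (chain-simple j) (chain-P4 j)

  chain-spine-edge : chain s (j * 3) (3 + j * 3) ≡ true
  chain-spine-edge = trans (keep _ _ (≤-trans (n≤1+n _) (n≤1+n _))) (proj₁ P4)

  chain-leaf-edge : chain s (1 + j * 3) (3 + j * 3) ≡ true
  chain-leaf-edge = trans (keep _ _ (n≤1+n _)) (proj₁ (proj₂ P4))

  chain-leaf-nonedge : chain s (j * 3) (1 + j * 3) ≡ false
  chain-leaf-nonedge = trans (keep _ _ (≤-trans (n≤1+n _) (n≤1+n _))) (proj₂ (proj₂ P4))

chain-cut : ∀ s i {X Y} → X ≤ 1 + i * 3 → 4 + i * 3 ≤ Y → chain s X Y ≡ false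
chain-cut s i {X} {Y} X≤1+3i 4+3i≤Y with i ℕ.<? s
... | yes i<s = begin
  chain s X Y        ≡⟨ chain-stable X Y (≤-trans (s≤s X≤1+3i) (n≤1+n _)) i<s ⟩
  chain (suc i) X Y  ≡⟨ pivot-farʳ (chain i) (chain-simple i) Y≁u Y≁v ⟩
  chain i X Y        ≡⟨ chain-untouchedʳ i X Y 1+3i≤Y ⟩
  pathℕ X Y          ≡⟨ pathℕ-apart< X Y X≪Y ⟩
  false              ∎
  where
    open ≡-Reasoning
    1+3i≤Y : 1 + i * 3 ≤ Y
    1+3i≤Y = ≤-trans (m≤n+m _ 3) 4+3i≤Y
    Y≁u : chain i Y (1 + i * 3) ≡ false
    Y≁u = trans (chain-untouched i Y _ 1+3i≤Y) (pathℕ-apart> Y _ (≤-trans (n≤1+n _) 4+3i≤Y))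
    Y≁v : chain i Y (2 + i * 3) ≡ false
    Y≁v = trans (chain-untouched i Y _ 1+3i≤Y) (pathℕ-apart> Y _ 4+3i≤Y)
    X≪Y : 2 + X ≤ Y
    X≪Y = ≤-trans (s≤s (s≤s X≤1+3i)) (≤-trans (n≤1+n _) 4+3i≤Y)
... | no i≮s = trans (chain-untouchedʳ s X Y 1+3s≤Y) (pathℕ-apart< X Y X≪Y)
  where
    1+3s≤Y : 1 + s * 3 ≤ Y
    1+3s≤Y = ≤-trans (s≤s (*-monoˡ-≤ 3 (≮⇒≥ i≮s))) (≤-trans (m≤n+m _ 3) 4+3i≤Y)
    X≪Y : 2 + X ≤ Y
    X≪Y = ≤-trans (s≤s (s≤s X≤1+3i)) (≤-trans (n≤1+n _) 4+3i≤Y)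

chain-cut′ : ∀ s i {X Y} → Y ≤ 1 + i * 3 → 4 + i * 3 ≤ X → chain s X Y ≡ false
chain-cut′ s i {X} {Y} Y≤1+3i 4+3i≤X = trans (chain-sym s X Y) (chain-cut s i Y≤1+3i 4+3i≤X)

-- Sites two steps apart along the spine are separated by a cut.
apart-sites : ∀ {i j} → 2 + i ≤ j → 4 + i * 3 ≤ j * 3
apart-sites {i} i≪j = ≤-trans (m≤n+m (4 + i * 3) 2) (*-monoˡ-≤ 3 i≪j)

-- The restriction of 'chain s' to the sites i*3 (spine, i ≤ s) and 1 + j*3
-- (leaf of spine vertex j+1, j < s) is a caterpillar.
chain-spine : ∀ {s i j} → i ≤ s → j ≤ s → chain s (i * 3) (j * 3) ≡ pathℕ i j
chain-spine {s} {i} {j} i≤s j≤s with gap i j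
... | same       = trans (Simple.loopless (chain-simple s) _) (sym (Simple.loopless pathℕ-simple i))
... | next       = trans (chain-spine-edge j≤s) (sym (pathℕ-next i))
... | prev       = trans (chain-sym s _ _)
                     (trans (chain-spine-edge i≤s) (sym (trans (Simple.symmetric pathℕ-simple i j) (pathℕ-next j))))
... | apart< i≪j = trans (chain-cut s i (n≤1+n _) (apart-sites i≪j)) (sym (pathℕ-apart< i j i≪j))
... | apart> j≪i = trans (chain-cut′ s j (n≤1+n _) (apart-sites j≪i)) (sym (pathℕ-apart> i j j≪i))

chain-leaf : ∀ {s j} i → j < s → chain s (1 + j * 3) (i * 3) ≡ ⌊ i ℕ.≟ suc j ⌋
chain-leaf {s} {j} i j<s with i ℕ.≟ suc j
... | yes refl = chain-leaf-edge j<s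
... | no i≢1+j with gap j i
...   | same       = trans (chain-sym s _ _) (chain-leaf-nonedge j<s)
...   | next       = contradiction refl i≢1+j
...   | prev       = chain-cut′ s i (n≤1+n _) ≤-refl
...   | apart< j≪i = chain-cut s j ≤-refl (apart-sites j≪i)
...   | apart> i≪j = chain-cut′ s i (n≤1+n _) (≤-trans (apart-sites i≪j) (n≤1+n _))

chain-leaves : ∀ s i j → chain s (1 + i * 3) (1 + j * 3) ≡ false
chain-leaves s i j with gap i j
... | same       = Simple.loopless (chain-simple s) _
... | next       = chain-cut s i ≤-refl ≤-refl
... | prev       = chain-cut′ s j ≤-refl ≤-refl
... | apart< i≪j = chain-cut s i ≤-refl (≤-trans (apart-sites i≪j) (n≤1+n _))
... | apart> j≪i = chain-cut′ s j ≤-refl (≤-trans (apart-sites j≪i) (n≤1+n _))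

Restricts : ∀ {m} → Graph m → (ℕ → ℕ → Bool) → Set
Restricts H E = ∀ x y → H x y ≡ E (toℕ x) (toℕ y)

≟-toℕ : ∀ {m} (x y : Fin m) → ⌊ x F.≟ y ⌋ ≡ ⌊ toℕ x ℕ.≟ toℕ y ⌋
≟-toℕ x y with x F.≟ y | toℕ x ℕ.≟ toℕ y
... | yes _   | yes _    = refl
... | no _    | no _     = refl
... | yes x≡y | no x≢y   = contradiction (cong toℕ x≡y) x≢y
... | no x≢y  | yes x≡y  = contradiction (toℕ-injective x≡y) x≢y

restricts-lc : ∀ {m} {H : Graph m} {E} w → Restricts H E → Restricts (localComp H w) (lc E (toℕ w))
restricts-lc w r x y rewrite r x y | r x w | r y w | ≟-toℕ x y = refl

restricts-pivot : ∀ {m} {H : Graph m} {E} u v →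
  Restricts H E → Restricts (pivot H u v) (pivotAt E (toℕ u) (toℕ v))
restricts-pivot {E = E} u v r =
  restricts-lc {E = lc (lc E (toℕ u)) (toℕ v)} u (restricts-lc {E = lc E (toℕ u)} v (restricts-lc {E = E} u r))

module PivotedPath (s : ℕ) where

  size : ℕ
  size = suc (s * 3)

  vertex : ℕ → Fin size
  vertex X = X mod size

  toℕ-vertex : ∀ {X} → X ≤ s * 3 → toℕ (vertex X) ≡ X
  toℕ-vertex X≤3s = trans (toℕ-fromℕ< _) (m<n⇒m%n≡m (s≤s X≤3s))

  pivoted : ℕ → Graph size
  pivoted zero    = pathGraph size
  pivoted (suc j) = pivot (pivoted j) (vertex (1 + j * 3)) (vertex (2 + j * 3))

  private
    u≤3s : ∀ {j} → j < s → 1 + j * 3 ≤ s * 3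
    u≤3s j<s = ≤-trans (≤-trans (n≤1+n _) (n≤1+n _)) (*-monoˡ-≤ 3 j<s)

    v≤3s : ∀ {j} → j < s → 2 + j * 3 ≤ s * 3
    v≤3s j<s = ≤-trans (n≤1+n _) (*-monoˡ-≤ 3 j<s)

  pivoted-restricts : ∀ j → j ≤ s → Restricts (pivoted j) (chain j)
  pivoted-restricts zero    _   x y = refl
  pivoted-restricts (suc j) j<s x y =
    trans (restricts-pivot {E = chain j} _ _ (pivoted-restricts j (<⇒≤ j<s)) x y)
          (cong₂ (λ u v → pivotAt (chain j) u v (toℕ x) (toℕ y))
                 (toℕ-vertex (u≤3s j<s)) (toℕ-vertex (v≤3s j<s)))

  pivoted-edge : ∀ {j} → j < s → pivoted j (vertex (1 + j * 3)) (vertex (2 + j * 3)) ≡ true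
  pivoted-edge {j} j<s = begin
    pivoted j (vertex (1 + j * 3)) (vertex (2 + j * 3)) ≡⟨ pivoted-restricts j (<⇒≤ j<s) _ _ ⟩
    chain j (toℕ (vertex (1 + j * 3))) (toℕ (vertex (2 + j * 3)))
      ≡⟨ cong₂ (chain j) (toℕ-vertex (u≤3s j<s)) (toℕ-vertex (v≤3s j<s)) ⟩
    chain j (1 + j * 3) (2 + j * 3) ≡⟨ chain-untouched j _ _ ≤-refl ⟩
    pathℕ (1 + j * 3) (2 + j * 3)   ≡⟨ pathℕ-next (1 + j * 3) ⟩
    true                            ∎
    where open ≡-Reasoning

  unpivot : ∀ {n} {H : Graph n} j → j ≤ s → H ≤pm pivoted j → H ≤pm pathGraph size
  unpivot zero    _   H≤ = H≤
  unpivot (suc j) j<s H≤ = unpivot j (<⇒≤ j<s) (piv _ _ (pivoted-edge j<s) H≤)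

-- An embedding of H as an induced subgraph of K makes H a pivot-minor of K:
-- delete the vertices outside the image one at a time; once none is left,
-- the embedding is an isomorphism.
embedding⇒≤pm : ∀ {n} m {H : Graph n} {K : Graph m} (g : Fin n → Fin m) →
  Injective _≡_ _≡_ g → (∀ x y → H x y ≡ K (g x) (g y)) → H ≤pm K
embedding⇒≤pm {n} m {H} {K} g g-inj g-induced with any? (λ i → all? (λ x → ¬? (g x F.≟ i)))
embedding⇒≤pm zero    g _ _ | yes (() , _)
embedding⇒≤pm (suc m) {H} {K} g g-inj g-induced | yes (i , i∉img) =
  del i (embedding⇒≤pm m g′ g′-inj g′-induced)
  where
    gx≢i : ∀ x → i ≢ g x
    gx≢i x = i∉img x ∘ sym
    g′ : Fin _ → Fin m
    g′ x = punchOut (gx≢i x)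
    g′-inj : Injective _≡_ _≡_ g′
    g′-inj {x} {y} = g-inj ∘ punchOut-injective (gx≢i x) (gx≢i y)
    g′-induced : ∀ x y → H x y ≡ delete K i (g′ x) (g′ y)
    g′-induced x y rewrite punchIn-punchOut (gx≢i x) | punchIn-punchOut (gx≢i y) = g-induced x y
embedding⇒≤pm m g g-inj g-induced | no img-full = iso (mk⤖ (g-inj , g-surj) , g-induced)
  where
    g-surj : Surjective _≡_ _≡_ g
    g-surj i with any? (λ x → g x F.≟ i)
    ... | yes (x , gx≡i) = x , λ { refl → gx≡i }
    ... | no i∉img      = contradiction (i , λ x gx≡i → i∉img (x , gx≡i)) img-full

unique-⊆⇒length≤ : ∀ {A : Set} → DecidableEquality A → ∀ {xs ys : List A} →
  Unique xs → (∀ {z} → z ∈ xs → z ∈ ys) → length xs ≤ length ys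
unique-⊆⇒length≤ _≟_ {[]}     _            _  = z≤n
unique-⊆⇒length≤ _≟_ {x ∷ xs} {ys} (x∉xs ∷ xs!) xs⊆ys =
  ≤-trans (s≤s (unique-⊆⇒length≤ _≟_ xs! xs⊆ys-x))
          (filter-notAll (λ z → ¬? (z ≟ x)) ys (Any.map (λ { refl x≢x → x≢x refl }) (xs⊆ys (here refl))))
  where
    xs⊆ys-x : ∀ {z} → z ∈ xs → z ∈ filter (λ z → ¬? (z ≟ x)) ys
    xs⊆ys-x z∈xs = ∈-filter⁺ (λ z → ¬? (z ≟ x)) (xs⊆ys (there z∈xs)) (All.lookup x∉xs z∈xs ∘ sym)

module Degree {n : ℕ} (G : Graph n) (v : Fin n) where

  private
    adjacent? = λ y → G v y ≟ᵇ true

    neighbours : List (Fin n)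
    neighbours = filter adjacent? (allFin n)

    count≡length : ∀ xs → sum (map (λ x → if G v x then 1 else 0) xs) ≡ length (filter adjacent? xs)
    count≡length []       = refl
    count≡length (x ∷ xs) with G v x
    ... | true  = cong suc (count≡length xs)
    ... | false = count≡length xs

    deg≡ : deg G v ≡ length neighbours
    deg≡ = count≡length (allFin n)

  deg-≤ : (ys : List (Fin n)) → (∀ y → G v y ≡ true → y ∈ ys) → deg G v ≤ length ys
  deg-≤ ys nbrs⊆ys = subst (_≤ length ys) (sym deg≡)
    (unique-⊆⇒length≤ F._≟_ (Unique.filter⁺ adjacent? (Unique.allFin⁺ n))
                      (λ {z} z∈ → nbrs⊆ys z (proj₂ (∈-filter⁻ adjacent? {xs = allFin n} z∈))))

  deg-≥ : (ys : List (Fin n)) → Unique ys → (∀ {y} → y ∈ ys → G v y ≡ true) → length ys ≤ deg G v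
  deg-≥ ys ys! ys⊆nbrs = subst (length ys ≤_) (sym deg≡)
    (unique-⊆⇒length≤ F._≟_ ys! (λ {z} z∈ → ∈-filter⁺ adjacent? (∈-allFin z) (ys⊆nbrs z∈)))

module TreeSpine {n : ℕ} (G : Graph n) (simple : IsSimple G) (acyclic : ¬ HasCycle G) where
  open IsSimple simple

  edge-sym : ∀ {x y} → G x y ≡ true → G y x ≡ true
  edge-sym {x} {y} x∼y = trans (symmetric y x) x∼y

  edge⇒≢ : ∀ {x y} → G x y ≡ true → x ≢ y
  edge⇒≢ {x} x∼x refl = contradiction (trans (sym x∼x) (irreflexive x)) λ ()

  record Spine : Set where
    field
      L          : ℕ
      p          : ℕ → Fin n
      L≥1        : 1 ≤ L
      p-inj      : ∀ {i j} → i < L → j < L → p i ≡ p j → i ≡ j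
      p-adj      : ∀ {i} → suc i < L → G (p i) (p (suc i)) ≡ true
      dominating : ∀ x → ∃ λ i → i < L × (x ≡ p i ⊎ G x (p i) ≡ true)

  module OnSpine (sp : Spine) where
    open Spine sp

    OffSpine : Fin n → Set
    OffSpine x = ∀ i → i < L → p i ≢ x

    -- segment i d = p i, p (i+1), …, p (i+d); written with an explicit head
    -- so that walks along it can be built by 'cons'.
    segment : ℕ → ℕ → List (Fin n)
    after   : ℕ → ℕ → List (Fin n)
    segment i d = p i ∷ after i d
    after i zero    = []
    after i (suc d) = segment (suc i) d

    after-length : ∀ i d → length (after i d) ≡ d
    after-length i zero    = refl
    after-length i (suc d) = cong suc (after-length (suc i) d)

    ∈-segment : ∀ i d {z} → z ∈ segment i d → ∃ λ j → i ≤ j × j ≤ i + d × z ≡ p j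
    ∈-segment i d       (here z≡pi) = i , ≤-refl , m≤m+n i d , z≡pi
    ∈-segment i (suc d) (there z∈)  with ∈-segment (suc i) d z∈
    ... | j , i<j , j≤ , z≡pj = j , ≤-trans (n≤1+n i) i<j , ≤-trans j≤ (≤-reflexive (sym (+-suc i d))) , z≡pj

    segment-walk : ∀ i d {rest} → i + d < L → IsWalk G (p (i + d) ∷ rest) → IsWalk G (segment i d ++ rest)
    segment-walk i zero    {rest} _     w = subst (λ j → IsWalk G (p j ∷ rest)) (+-identityʳ i) w
    segment-walk i (suc d) {rest} i+d<L w =
      cons (p-adj (≤-trans (s≤s (s≤s (m≤m+n i d))) i+d<L′))
           (segment-walk (suc i) d i+d<L′ (subst (λ j → IsWalk G (p j ∷ rest)) (+-suc i d) w))
      where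
        i+d<L′ : suc i + d < L
        i+d<L′ = subst (_< L) (+-suc i d) i+d<L

    segment-unique : ∀ i d → i + d < L → Unique (segment i d)
    segment-unique i zero    _     = [] ∷ []
    segment-unique i (suc d) i+d<L = All.tabulate pi∉ ∷ segment-unique (suc i) d i+d<L′
      where
        i+d<L′ : suc i + d < L
        i+d<L′ = subst (_< L) (+-suc i d) i+d<L
        pi∉ : ∀ {z} → z ∈ after i (suc d) → p i ≢ z
        pi∉ z∈ pi≡z with ∈-segment (suc i) d z∈
        ... | j , i<j , j≤ , z≡pj with p-inj (≤-trans (s≤s (m≤m+n i (suc d))) i+d<L) (≤-trans (s≤s j≤) i+d<L′)
                                             (trans pi≡z z≡pj)
        ... | refl = <-irrefl refl i<j

    off-segment : ∀ {x} → OffSpine x → ∀ i d → i + d < L → ¬ (x ∈ segment i d)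
    off-segment x-off i d i+d<L x∈ with ∈-segment i d x∈
    ... | j , _ , j≤ , x≡pj = x-off j (≤-trans (s≤s j≤) i+d<L) (sym x≡pj)

    -- The spine segment from p i to p j closed up by a path through
    -- off-spine vertices would be a cycle.
    no-closed-detour : ∀ i d {j} (ext : List (Fin n)) → i + d ≡ j → j < L →
      All OffSpine ext → Unique ext → 2 ≤ d + length ext → IsWalk G (p j ∷ ext ++ p i ∷ []) → ⊥
    no-closed-detour i d ext refl j<L ext-off ext! 2≤ w =
      acyclic (p i , after i d ++ ext , long , Unique.++⁺ (segment-unique i d j<L) ext! disjoint , walk)
      where
        long : 2 ≤ length (after i d ++ ext)
        long = subst (2 ≤_) (sym (trans (length-++ (after i d)) (cong (_+ length ext) (after-length i d)))) 2≤
        disjoint : ∀ {z} → ¬ (z ∈ segment i d × z ∈ ext)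
        disjoint (z∈seg , z∈ext) = off-segment (All.lookup ext-off z∈ext) i d j<L z∈seg
        walk : IsWalk G (p i ∷ (after i d ++ ext) ++ p i ∷ [])
        walk = subst (IsWalk G) (sym (++-assoc (segment i d) ext (p i ∷ []))) (segment-walk i d j<L w)

    chordless : ∀ {i j} → j < L → 2 + i ≤ j → G (p i) (p j) ≡ false
    chordless {i} {j} j<L i≪j with m≤n⇒∃[o]m+o≡n i≪j
    ... | o , refl = ¬-not λ pi∼pj →
      no-closed-detour i (2 + o) [] (trans (+-suc i (suc o)) (cong suc (+-suc i o))) j<L [] [] (s≤s (s≤s z≤n))
                       (cons (edge-sym pi∼pj) (one (p i)))

    no-two-spine-neighbours : ∀ {x a b} → OffSpine x → a < b → b < L →
      G x (p a) ≡ true → G x (p b) ≡ true → ⊥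
    no-two-spine-neighbours {x} {a} x-off a<b b<L x∼pa x∼pb with m≤n⇒∃[o]m+o≡n a<b
    ... | o , refl = no-closed-detour a (suc o) (x ∷ []) (+-suc a o) b<L (x-off ∷ []) ([] ∷ [])
                                      (s≤s (m≤n+m 1 o)) (cons (edge-sym x∼pb) (cons x∼pa (one (p a))))

    one-spine-neighbour : ∀ {x i j} → OffSpine x → i < L → j < L →
      G x (p i) ≡ true → G x (p j) ≡ true → i ≡ j
    one-spine-neighbour {i = i} {j} x-off i<L j<L x∼pi x∼pj with <-cmp i j
    ... | tri≈ _ i≡j _ = i≡j
    ... | tri< i<j _ _ = ⊥-elim (no-two-spine-neighbours x-off i<j j<L x∼pi x∼pj)
    ... | tri> _ _ j<i = ⊥-elim (no-two-spine-neighbours x-off j<i i<L x∼pj x∼pi)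

    spine-neighbour : ∀ {x} → OffSpine x → ∃ λ i → i < L × G x (p i) ≡ true
    spine-neighbour {x} x-off with dominating x
    ... | i , i<L , inj₁ x≡pi = contradiction (sym x≡pi) (x-off i i<L)
    ... | i , i<L , inj₂ x∼pi = i , i<L , x∼pi

    private
      no-off-spine-edge : ∀ {x y i j} → OffSpine x → OffSpine y → i ≤ j → j < L →
        G x (p i) ≡ true → G y (p j) ≡ true → G x y ≡ true → ⊥
      no-off-spine-edge {x} {y} {i} x-off y-off i≤j j<L x∼pi y∼pj x∼y with m≤n⇒∃[o]m+o≡n i≤j
      ... | o , refl = no-closed-detour i o (y ∷ x ∷ []) refl j<L (y-off ∷ x-off ∷ [])
                         (((λ y≡x → edge⇒≢ x∼y (sym y≡x)) ∷ []) ∷ [] ∷ []) (m≤n+m 2 o)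
                         (cons (edge-sym y∼pj) (cons (edge-sym x∼y) (cons x∼pi (one (p i)))))

    off-spine-independent : ∀ {x y} → OffSpine x → OffSpine y → G x y ≡ false
    off-spine-independent {x} {y} x-off y-off with spine-neighbour x-off | spine-neighbour y-off
    ... | i , i<L , x∼pi | j , j<L , y∼pj with ≤-total i j
    ...   | inj₁ i≤j = ¬-not (no-off-spine-edge x-off y-off i≤j j<L x∼pi y∼pj)
    ...   | inj₂ j≤i = ¬-not (λ x∼y → no-off-spine-edge y-off x-off j≤i i<L y∼pj x∼pi (edge-sym x∼y))

    isSpine? : ∀ x → Dec (∃ λ i → i < L × p i ≡ x)
    isSpine? x with any? {n = L} (λ i → p (F.toℕ i) F.≟ x)
    ... | yes (i , pi≡x) = yes (F.toℕ i , toℕ<n i , pi≡x)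
    ... | no ¬spine      = no λ { (i , i<L , pi≡x) →
                              ¬spine (F.fromℕ< i<L , subst (λ j → p j ≡ x) (sym (toℕ-fromℕ< i<L)) pi≡x) }

    off-spine : ∀ {x} → ¬ (∃ λ i → i < L × p i ≡ x) → OffSpine x
    off-spine ¬spine i i<L pi≡x = ¬spine (i , i<L , pi≡x)

    off-spine-pendant : ∀ {x i} → OffSpine x → i < L → G x (p i) ≡ true → ∀ y → G x y ≡ true → y ≡ p i
    off-spine-pendant {x} x-off i<L x∼pi y x∼y with isSpine? y
    ... | yes (j , j<L , refl) = cong p (one-spine-neighbour x-off j<L i<L x∼y x∼pi)
    ... | no ¬spine = contradiction (trans (sym x∼y) (off-spine-independent x-off (off-spine ¬spine))) λ ()

  open Spine
  open OnSpine using (OffSpine)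

  _◂_ : Fin n → (ℕ → Fin n) → ℕ → Fin n
  (y ◂ f) zero    = y
  (y ◂ f) (suc i) = f i

  prepend : (sp : Spine) (y : Fin n) → OffSpine sp y → G (p sp 0) y ≡ true → Spine
  prepend sp y y-off p0∼y = record
    { L = suc (L sp) ; p = y ◂ p sp ; L≥1 = s≤s z≤n ; p-inj = inj ; p-adj = adj ; dominating = dom }
    where
      inj : ∀ {i j} → i < suc (L sp) → j < suc (L sp) → (y ◂ p sp) i ≡ (y ◂ p sp) j → i ≡ j
      inj {zero}  {zero}  _   _   _  = refl
      inj {zero}  {suc j} _   j<L eq = contradiction (sym eq) (y-off j (≤-pred j<L))
      inj {suc i} {zero}  i<L _   eq = contradiction eq (y-off i (≤-pred i<L))
      inj {suc i} {suc j} i<L j<L eq = cong suc (p-inj sp (≤-pred i<L) (≤-pred j<L) eq)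
      adj : ∀ {i} → suc i < suc (L sp) → G ((y ◂ p sp) i) ((y ◂ p sp) (suc i)) ≡ true
      adj {zero}  _     = edge-sym p0∼y
      adj {suc i} i+1<L = p-adj sp (≤-pred i+1<L)
      dom : ∀ x → ∃ λ i → i < suc (L sp) × (x ≡ (y ◂ p sp) i ⊎ G x ((y ◂ p sp) i) ≡ true)
      dom x with dominating sp x
      ... | i , i<L , near = suc i , s≤s i<L , near

  last : Spine → Fin n
  last sp = p sp (pred (L sp))

  last-prepend : ∀ sp y y-off p0∼y → last (prepend sp y y-off p0∼y) ≡ last sp
  last-prepend sp _ _ _ with L sp | L≥1 sp
  ... | suc _ | _ = refl

  reverse : Spine → Spine
  reverse sp = record
    { L = L sp ; p = λ i → p sp (r ∸ i) ; L≥1 = L≥1 sp ; p-inj = inj ; p-adj = adj ; dominating = dom }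
    where
      r = pred (L sp)
      i≤r : ∀ {i} → i < L sp → i ≤ r
      i≤r = <⇒≤pred
      r<L : ∀ {m} → 1 ≤ m → pred m < m
      r<L (s≤s _) = ≤-refl
      r∸i<L : ∀ i → r ∸ i < L sp
      r∸i<L i = ≤-<-trans (m∸n≤m r i) (r<L (L≥1 sp))
      inj : ∀ {i j} → i < L sp → j < L sp → p sp (r ∸ i) ≡ p sp (r ∸ j) → i ≡ j
      inj {i} {j} i<L j<L eq = ∸-cancelˡ-≡ (i≤r i<L) (i≤r j<L) (p-inj sp (r∸i<L i) (r∸i<L j) eq)
      adj : ∀ {i} → suc i < L sp → G (p sp (r ∸ i)) (p sp (r ∸ suc i)) ≡ true
      adj {i} i+1<L = subst (λ j → G (p sp j) (p sp (r ∸ suc i)) ≡ true) (sym r∸i≡)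
                        (edge-sym (p-adj sp (subst (_< L sp) r∸i≡ (r∸i<L i))))
        where
          r∸i≡ : r ∸ i ≡ suc (r ∸ suc i)
          r∸i≡ = +-∸-assoc 1 {r} (i≤r i+1<L)
      dom : ∀ x → ∃ λ i → i < L sp × (x ≡ p sp (r ∸ i) ⊎ G x (p sp (r ∸ i)) ≡ true)
      dom x with dominating sp x
      ... | i , i<L , near = r ∸ i , r∸i<L i , subst (λ j → x ≡ p sp j ⊎ G x (p sp j) ≡ true)
                                                      (sym (m∸[m∸n]≡n (i≤r i<L))) near

  last-reverse : ∀ sp → last (reverse sp) ≡ p sp 0
  last-reverse sp = cong (p sp) (n∸n≡0 (pred (L sp)))

  nth : Fin n → List (Fin n) → ℕ → Fin n
  nth d []       _       = d
  nth d (x ∷ xs) zero    = x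
  nth d (x ∷ xs) (suc i) = nth d xs i

  nth-∈ : ∀ d xs {i} → i < length xs → nth d xs i ∈ xs
  nth-∈ d (x ∷ xs) {zero}  _     = here refl
  nth-∈ d (x ∷ xs) {suc i} i<len = there (nth-∈ d xs (≤-pred i<len))

  nth-inj : ∀ d {xs} → Unique xs → ∀ {i j} → i < length xs → j < length xs → nth d xs i ≡ nth d xs j → i ≡ j
  nth-inj d {x ∷ xs} (x∉ ∷ xs!) {zero}  {zero}  _ _ _  = refl
  nth-inj d {x ∷ xs} (x∉ ∷ xs!) {zero}  {suc j} _ j< eq = contradiction eq (All.lookup x∉ (nth-∈ d xs (≤-pred j<)))
  nth-inj d {x ∷ xs} (x∉ ∷ xs!) {suc i} {zero}  i< _ eq = contradiction (sym eq) (All.lookup x∉ (nth-∈ d xs (≤-pred i<)))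
  nth-inj d {x ∷ xs} (x∉ ∷ xs!) {suc i} {suc j} i< j< eq = cong suc (nth-inj d xs! (≤-pred i<) (≤-pred j<) eq)

  nth-walk : ∀ d {xs} → IsWalk G xs → ∀ {i} → suc i < length xs → G (nth d xs i) (nth d xs (suc i)) ≡ true
  nth-walk d (one x)      (s≤s ())
  nth-walk d (cons x∼y w) {zero}  _       = x∼y
  nth-walk d (cons x∼y w) {suc i} i+1<len = nth-walk d w (≤-pred i+1<len)

  nth-any : ∀ d {P : Fin n → Set} {xs} → Any P xs → ∃ λ i → i < length xs × P (nth d xs i)
  nth-any d (here px) = zero , s≤s z≤n , px
  nth-any d (there pxs) with nth-any d pxs
  ... | i , i<len , px = suc i , s≤s i<len , px

  caterpillar-spine : IsCaterpillar G → Spine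
  caterpillar-spine cat with IsCaterpillar.spine cat | IsCaterpillar.spinePath cat | IsCaterpillar.dominated cat
  ... | []     | () , _ | _
  ... | x ∷ xs | len≥1 , xs! , walk | dom = record
    { L = length (x ∷ xs) ; p = nth x (x ∷ xs) ; L≥1 = len≥1 ; p-inj = nth-inj x xs!
    ; p-adj = nth-walk x walk ; dominating = λ y → nth-any x (dom y) }

module SubcubicCaterpillar {n : ℕ} (G : Graph n) (simple : IsSimple G) (acyclic : ¬ HasCycle G)
                           (degree : ∀ v → deg G v ≡ 1 ⊎ deg G v ≡ 3) where
  open IsSimple simple
  open TreeSpine G simple acyclic
  open Spine
  open OnSpine

  deg≤3 : ∀ v → deg G v ≤ 3
  deg≤3 v with degree v
  ... | inj₁ d≡1 = subst (_≤ 3) (sym d≡1) (s≤s z≤n)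
  ... | inj₂ d≡3 = subst (_≤ 3) (sym d≡3) ≤-refl

  deg≤1⇒leaf : ∀ {v} → deg G v ≤ 1 → deg G v ≡ 1
  deg≤1⇒leaf {v} d≤1 with degree v
  ... | inj₁ d≡1 = d≡1
  ... | inj₂ d≡3 = contradiction (subst (_≤ 1) d≡3 d≤1) λ { (s≤s ()) }

  leaf-unique-neighbour : ∀ {v a b} → deg G v ≡ 1 → G v a ≡ true → G v b ≡ true → a ≡ b
  leaf-unique-neighbour {v} {a} {b} d≡1 v∼a v∼b with a F.≟ b
  ... | yes a≡b = a≡b
  ... | no  a≢b = contradiction (subst (2 ≤_) d≡1 (Degree.deg-≥ G v (a ∷ b ∷ []) ((a≢b ∷ []) ∷ [] ∷ []) nbrs))
                                λ { (s≤s ()) }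
    where
      nbrs : ∀ {y} → y ∈ a ∷ b ∷ [] → G v y ≡ true
      nbrs (here refl)         = v∼a
      nbrs (there (here refl)) = v∼b

  no-four-neighbours : ∀ {v a b c d} → Unique (a ∷ b ∷ c ∷ d ∷ []) →
    G v a ≡ true → G v b ≡ true → G v c ≡ true → G v d ≡ true → ⊥
  no-four-neighbours {v} {a} {b} {c} {d} distinct v∼a v∼b v∼c v∼d =
    <-irrefl refl (≤-trans (Degree.deg-≥ G v _ distinct nbrs) (deg≤3 v))
    where
      nbrs : ∀ {y} → y ∈ a ∷ b ∷ c ∷ d ∷ [] → G v y ≡ true
      nbrs (here refl)                         = v∼a
      nbrs (there (here refl))                 = v∼b
      nbrs (there (there (here refl)))         = v∼c
      nbrs (there (there (there (here refl)))) = v∼d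

  off-spine-leaf : ∀ sp {x} → OffSpine sp x → deg G x ≡ 1
  off-spine-leaf sp x-off with spine-neighbour sp x-off
  ... | i , i<L , x∼pi = deg≤1⇒leaf (Degree.deg-≤ G _ (p sp i ∷ [])
                             λ y x∼y → here (off-spine-pendant sp x-off i<L x∼pi y x∼y))

  deg≥1 : ∀ v → 1 ≤ deg G v
  deg≥1 v with degree v
  ... | inj₁ d≡1 = ≤-reflexive (sym d≡1)
  ... | inj₂ d≡3 = subst (1 ≤_) (sym d≡3) (s≤s z≤n)

  start-spine-neighbour : ∀ sp {y} → G (p sp 0) y ≡ true → (∃ λ j → j < L sp × p sp j ≡ y) →
    1 < L sp × y ≡ p sp 1
  start-spine-neighbour sp p0∼y (zero , _ , refl) =
    contradiction (trans (sym p0∼y) (irreflexive _)) λ ()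
  start-spine-neighbour sp p0∼y (suc zero , 1<L , refl) = 1<L , refl
  start-spine-neighbour sp p0∼y (suc (suc j) , j<L , refl) =
    contradiction (trans (sym p0∼y) (chordless sp j<L (s≤s (s≤s z≤n)))) λ ()

  record LeafStart (sp : Spine) : Set where
    field
      spine′     : Spine
      long       : 2 ≤ L spine′
      first-leaf : deg G (p spine′ 0) ≡ 1
      same-last  : last spine′ ≡ last sp

  private
    StartOnSpine : Spine → Set
    StartOnSpine sp = ∀ y → G (p sp 0) y ≡ true → ∃ λ j → j < L sp × p sp j ≡ y

    -- Prepend an off-spine neighbour of the first vertex, which is a leaf.
    extend : ∀ sp → ¬ StartOnSpine sp → LeafStart sp
    extend sp not-on-spine with any? (λ y → (G (p sp 0) y ≟ᵇ true) ×-dec ¬? (isSpine? sp y))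
    ... | yes (y , p0∼y , ¬spine) = record
      { spine′     = prepend sp y (off-spine sp ¬spine) p0∼y
      ; long       = s≤s (L≥1 sp)
      ; first-leaf = off-spine-leaf sp (off-spine sp ¬spine)
      ; same-last  = last-prepend sp y (off-spine sp ¬spine) p0∼y
      }
    ... | no none-off = contradiction on-spine not-on-spine
      where
        on-spine : StartOnSpine sp
        on-spine y p0∼y with isSpine? sp y
        ... | yes spine = spine
        ... | no ¬spine = contradiction (y , p0∼y , ¬spine) none-off

  -- The first vertex is kept if it is a leaf and the spine has two vertices;
  -- otherwise counting its degree shows it has an off-spine neighbour.
  leaf-start : ∀ sp → LeafStart sp
  leaf-start sp with 2 ≤? L sp | degree (p sp 0)
  ... | yes long | inj₁ d≡1 = record { spine′ = sp ; long = long ; first-leaf = d≡1 ; same-last = refl }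
  ... | yes long | inj₂ d≡3 = extend sp λ on-spine →
    contradiction (subst (_≤ 1) d≡3 (Degree.deg-≤ G _ (p sp 1 ∷ [])
                     λ y p0∼y → here (proj₂ (start-spine-neighbour sp p0∼y (on-spine y p0∼y)))))
                  λ { (s≤s ()) }
  ... | no short | _ = extend sp λ on-spine →
    contradiction (≤-trans (deg≥1 _) (Degree.deg-≤ G _ []
                     λ y p0∼y → contradiction (proj₁ (start-spine-neighbour sp p0∼y (on-spine y p0∼y))) short))
                  λ ()

  record LeafSpine : Set where
    field
      spine      : Spine
      k          : ℕ
      L≡         : L spine ≡ 2 + k
      first-leaf : deg G (p spine 0) ≡ 1
      last-leaf  : deg G (p spine (suc k)) ≡ 1

  -- Fix the start, reverse, and fix the start again.
  leaf-spine : Spine → LeafSpine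
  leaf-spine sp₀ = record
    { spine = sp ; k = L sp ∸ 2 ; L≡ = L≡ ; first-leaf = LeafStart.first-leaf second
    ; last-leaf = subst (λ m → deg G (p sp (pred m)) ≡ 1) L≡ last-leaf }
    where
      first  = leaf-start sp₀
      second = leaf-start (reverse (LeafStart.spine′ first))
      sp = LeafStart.spine′ second
      L≡ : L sp ≡ 2 + (L sp ∸ 2)
      L≡ = sym (m+[n∸m]≡n (LeafStart.long second))
      last-leaf : deg G (last sp) ≡ 1
      last-leaf = subst (λ v → deg G v ≡ 1)
                    (sym (trans (LeafStart.same-last second) (last-reverse (LeafStart.spine′ first))))
                    (LeafStart.first-leaf first)

  -- Label the vertices along a leaf-ended spine p 0, …, p s (s = suc k):
  -- spine vertex p i sits at i * 3, and the unique pendant leaf of the inner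
  -- vertex p (suc j) sits at 1 + j * 3.  These sites induce in 'chain s'
  -- exactly the adjacencies of G.
  module Sites (ls : LeafSpine) where
    open LeafSpine ls

    s : ℕ
    s = suc k

    private
      P = p spine

      ≤s⇒<L : ∀ {i} → i ≤ s → i < L spine
      ≤s⇒<L i≤s = subst (_ <_) (sym L≡) (s≤s i≤s)

    data Site (x : Fin n) : Set where
      spine-site : ∀ i → i ≤ s → P i ≡ x → Site x
      leaf-site  : ∀ j → j < k → OffSpine spine x → G x (P (suc j)) ≡ true → Site x

    end-no-pendant : ∀ {e e′ y} → deg G (P e) ≡ 1 → G (P e) (P e′) ≡ true → e′ < L spine →
      OffSpine spine y → G y (P e) ≡ true → ⊥
    end-no-pendant d≡1 pe∼pe′ e′<L y-off y∼pe =
      y-off _ e′<L (sym (leaf-unique-neighbour d≡1 (edge-sym y∼pe) pe∼pe′))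

    site : ∀ x → Site x
    site x with isSpine? spine x
    ... | yes (i , i<L , pi≡x) = spine-site i (≤-pred (subst (_ <_) L≡ i<L)) pi≡x
    ... | no ¬spine with spine-neighbour spine (off-spine spine ¬spine)
    ...   | zero , _ , x∼p0 =
      ⊥-elim (end-no-pendant first-leaf (p-adj spine (≤s⇒<L (s≤s z≤n))) (≤s⇒<L (s≤s z≤n))
                             (off-spine spine ¬spine) x∼p0)
    ...   | suc j , j+1<L , x∼pj+1 with j ℕ.<? k
    ...     | yes j<k = leaf-site j j<k (off-spine spine ¬spine) x∼pj+1
    ...     | no j≮k with ≤-antisym (≤-pred (≤-pred (subst (_ <_) L≡ j+1<L))) (≮⇒≥ j≮k)
    ...       | refl = ⊥-elim (end-no-pendant last-leaf (edge-sym (p-adj spine (≤s⇒<L ≤-refl)))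
                                              (≤s⇒<L (n≤1+n k)) (off-spine spine ¬spine) x∼pj+1)

    position : ∀ {x} → Site x → ℕ
    position (spine-site i _ _)  = i * 3
    position (leaf-site j _ _ _) = 1 + j * 3

    position≤ : ∀ {x} (σ : Site x) → position σ ≤ s * 3
    position≤ (spine-site i i≤s _)  = *-monoˡ-≤ 3 i≤s
    position≤ (leaf-site j j<k _ _) = ≤-trans (s≤s (*-monoˡ-≤ 3 (<⇒≤ j<k))) (m≤n+m _ 2)

    -- Each inner spine vertex carries at most one pendant leaf (degree ≤ 3).
    one-pendant : ∀ {j y y′} → j < k → OffSpine spine y → OffSpine spine y′ →
      G y (P (suc j)) ≡ true → G y′ (P (suc j)) ≡ true → y ≡ y′
    one-pendant {j} {y} {y′} j<k y-off y′-off y∼q y′∼q with y F.≟ y′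
    ... | yes y≡y′ = y≡y′
    ... | no  y≢y′ = ⊥-elim (no-four-neighbours distinct
                                 (edge-sym (p-adj spine j+1<L)) (p-adj spine j+2<L) (edge-sym y∼q) (edge-sym y′∼q))
      where
        j+2<L : 2 + j < L spine
        j+2<L = ≤s⇒<L (s≤s j<k)
        j+1<L : 1 + j < L spine
        j+1<L = ≤s⇒<L (<⇒≤ (s≤s j<k))
        j<L : j < L spine
        j<L = ≤s⇒<L (<⇒≤ (<⇒≤ (s≤s j<k)))
        pj≢pj+2 : P j ≢ P (2 + j)
        pj≢pj+2 eq with p-inj spine j<L j+2<L eq
        ... | ()
        distinct : Unique (P j ∷ P (2 + j) ∷ y ∷ y′ ∷ [])
        distinct = (pj≢pj+2 ∷ y-off j j<L ∷ y′-off j j<L ∷ [])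
                 ∷ (y-off (2 + j) j+2<L ∷ y′-off (2 + j) j+2<L ∷ [])
                 ∷ (y≢y′ ∷ []) ∷ [] ∷ []

    3i≢1+3j : ∀ i j → i * 3 ≢ 1 + j * 3
    3i≢1+3j zero    j       ()
    3i≢1+3j (suc i) zero    ()
    3i≢1+3j (suc i) (suc j) eq = 3i≢1+3j i j (suc-injective (suc-injective (suc-injective eq)))

    position-inj : ∀ {x y} (σ : Site x) (τ : Site y) → position σ ≡ position τ → x ≡ y
    position-inj (spine-site i _ refl) (spine-site j _ refl) eq = cong P (*-cancelʳ-≡ i j 3 eq)
    position-inj (spine-site i _ _) (leaf-site j _ _ _) eq = contradiction eq (3i≢1+3j i j)
    position-inj (leaf-site i _ _ _) (spine-site j _ _) eq = contradiction (sym eq) (3i≢1+3j j i)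
    position-inj (leaf-site i i<k x-off x∼q) (leaf-site j _ y-off y∼q′) eq
      with *-cancelʳ-≡ i j 3 (suc-injective eq)
    ... | refl = one-pendant i<k x-off y-off x∼q y∼q′

    graph-spine : ∀ {i j} → i ≤ s → j ≤ s → G (P i) (P j) ≡ pathℕ i j
    graph-spine {i} {j} i≤s j≤s with gap i j
    ... | same       = trans (irreflexive _) (sym (Simple.loopless pathℕ-simple i))
    ... | next       = trans (p-adj spine (≤s⇒<L j≤s)) (sym (pathℕ-next i))
    ... | prev       = trans (symmetric _ _)
                         (trans (p-adj spine (≤s⇒<L i≤s)) (sym (trans (Simple.symmetric pathℕ-simple i j) (pathℕ-next j))))
    ... | apart< i≪j = trans (chordless spine (≤s⇒<L j≤s) i≪j) (sym (pathℕ-apart< i j i≪j))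
    ... | apart> j≪i = trans (symmetric _ _) (trans (chordless spine (≤s⇒<L i≤s) j≪i) (sym (pathℕ-apart> i j j≪i)))

    graph-pendant : ∀ {j y} i → i ≤ s → j < k → OffSpine spine y → G y (P (suc j)) ≡ true →
      G y (P i) ≡ ⌊ i ℕ.≟ suc j ⌋
    graph-pendant {j} i i≤s j<k y-off y∼q with i ℕ.≟ suc j
    ... | yes refl = y∼q
    ... | no  i≢1+j = ¬-not λ y∼pi →
      i≢1+j (one-spine-neighbour spine y-off (≤s⇒<L i≤s) (≤s⇒<L (s≤s (<⇒≤ j<k))) y∼pi y∼q)

    site-adjacency : ∀ {x y} (σ : Site x) (τ : Site y) → G x y ≡ chain s (position σ) (position τ)
    site-adjacency (spine-site i i≤s refl) (spine-site j j≤s refl) =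
      trans (graph-spine i≤s j≤s) (sym (chain-spine i≤s j≤s))
    site-adjacency (spine-site i i≤s refl) (leaf-site j j<k y-off y∼q) =
      trans (symmetric _ _) (trans (graph-pendant i i≤s j<k y-off y∼q)
        (sym (trans (chain-sym s _ _) (chain-leaf i (s≤s (<⇒≤ j<k))))))
    site-adjacency (leaf-site j j<k x-off x∼q) (spine-site i i≤s refl) =
      trans (graph-pendant i i≤s j<k x-off x∼q) (sym (chain-leaf i (s≤s (<⇒≤ j<k))))
    site-adjacency (leaf-site i _ x-off _) (leaf-site j _ y-off _) =
      trans (off-spine-independent spine x-off y-off) (sym (chain-leaves s i j))

    -- Embed G at the sites of the fully pivoted path and undo the pivots.
    caterpillar≤pm : G ≤pm pathGraph (suc (s * 3))
    caterpillar≤pm = unpivot s ≤-refl (embedding⇒≤pm size g g-inj g-induced)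
      where
        open PivotedPath s
        g : Fin n → Fin size
        g x = vertex (position (site x))
        toℕ-g : ∀ x → toℕ (g x) ≡ position (site x)
        toℕ-g x = toℕ-vertex (position≤ (site x))
        g-inj : ∀ {x y} → g x ≡ g y → x ≡ y
        g-inj {x} {y} gx≡gy = position-inj (site x) (site y) (trans (sym (toℕ-g x)) (trans (cong toℕ gx≡gy) (toℕ-g y)))
        g-induced : ∀ x y → G x y ≡ pivoted s (g x) (g y)
        g-induced x y = trans (site-adjacency (site x) (site y))
          (sym (trans (pivoted-restricts s ≤-refl (g x) (g y)) (cong₂ (chain s) (toℕ-g x) (toℕ-g y))))

lemma4p2 : ∀ (n : ℕ) (G : Graph n) → IsSubcubicTree G → IsCaterpillar G →
    ∃ λ m → G ≤pm pathGraph m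
lemma4p2 n G subcubic caterpillar = suc (s * 3) , caterpillar≤pm
  where
    open IsSubcubicTree subcubic using (tree; degrees)
    open IsTree tree using (simple; acyclic)
    open SubcubicCaterpillar G simple acyclic degrees
    open Sites (leaf-spine (TreeSpine.caterpillar-spine G simple acyclic caterpillar))
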